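{- Let $\theta,n$ be integers with $n\ge\theta\ge 3$. If a graph $G$ has a $\theta$-connected set of size greater than $\binom{n}{\theta-1}(\theta-1)$, then $G$ has $\theta$-tree-width at least $n$.
   Context: A separation of $G$ is an ordered pair $(G_1,G_2)$ of subgraphs with $G=G_1\cup G_2$; its order is $\lambda(G_1,G_2)=|V(G_1)\cap V(G_2)|$. A set $U\subseteq V(G)$ is $\theta$-connected if $\min\{|U\cap V(G_1)|,|U\cap V(G_2)|\}\le\lambda(G_1,G_2)$ for every separation $(G_1,G_2)$ of $G$ of order less than $\theta$. Tree-decompositions: a tree-decomposition of $G$ is a tree $T$ such that $E(G)$ is a subset of the set of leaves of $T$. For $v\in V(G)$ let $T_v$ be the minimal subtree of $T$ containing all leaves of $T$ that are edges of $G$ incident with $v$. For a node $t$ the bag is $Y_t=\{v: t\in V(T_v)\}$, and for an edge $e=tt'$ of $T$, $Y_e=Y_t\cap Y_{t'}$. Width is $\max_t|Y_t|-1$, adhesion is $\max_e|Y_e|$. The $\theta$-tree-width of $G$ is the minimum width of a tree-decomposition of $G$ of adhesion less than $\theta$. -}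

module Defs where

open import Data.Nat using (ℕ; zero; suc; _+_; _*_; _∸_; _≤_; _<_; _⊓_)
open import Data.Fin as F using (Fin; zero; suc; inject₁; fromℕ)
open import Data.Fin.Subset as S using (Subset; _∈_; _∩_; ∣_∣)
open import Data.Bool using (Bool; true; false)
open import Data.Product using (Σ; _×_; _,_; proj₁; proj₂; ∃)
open import Data.Sum using (_⊎_)
open import Data.Empty using (⊥)
open import Relation.Binary.PropositionalEquality using (_≡_)
open import Function.Definitions using (Injective)

record Graph : Set where
  field
    size   : ℕ
    adj    : Fin size → Fin size → Bool
    symm   : ∀ u v → adj u v ≡ adj v u
    irrefl : ∀ v → adj v v ≡ false
open Graph public

Vertex : Graph → Set
Vertex G = Fin (size G)

-- An edge is an unordered pair {u,v} of adjacent vertices, represented with u < v.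
Edge : Graph → Set
Edge G = Σ (Fin (size G) × Fin (size G)) λ p → (proj₁ p F.< proj₂ p) × (adj G (proj₁ p) (proj₂ p) ≡ true)

Incident : (G : Graph) → Vertex G → Edge G → Set
Incident G v e = (proj₁ (proj₁ e) ≡ v) ⊎ (proj₂ (proj₁ e) ≡ v)

record Subgraph (G : Graph) : Set₁ where
  field
    verts  : Subset (size G)
    edges  : Edge G → Set
    closed : ∀ e → edges e → (proj₁ (proj₁ e) ∈ verts) × (proj₂ (proj₁ e) ∈ verts)
open Subgraph public

record Separation (G : Graph) : Set₁ where
  field
    G₁ G₂   : Subgraph G
    coverV  : ∀ v → (v ∈ verts G₁) ⊎ (v ∈ verts G₂)
    coverE  : ∀ e → edges G₁ e ⊎ edges G₂ e
open Separation public

order : {G : Graph} → Separation G → ℕ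
order s = ∣ verts (G₁ s) ∩ verts (G₂ s) ∣

ThetaConnected : (θ : ℕ) (G : Graph) → Subset (size G) → Set₁
ThetaConnected θ G U =
  (s : Separation G) → order s < θ →
  (∣ U ∩ verts (G₁ s) ∣ ⊓ ∣ U ∩ verts (G₂ s) ∣) ≤ order s

data Reach (G : Graph) (X : Subset (size G)) : Vertex G → Vertex G → Set where
  here : ∀ {s} → s ∈ X → Reach G X s s
  step : ∀ {s u t} → s ∈ X → adj G s u ≡ true → Reach G X u t → Reach G X s t

-- X induces a connected subgraph (the empty set counts as connected).
ConnectedSet : (G : Graph) → Subset (size G) → Set
ConnectedSet G X = ∀ s t → s ∈ X → t ∈ X → Reach G X s t

-- No cycle v₀ v₁ … v_{k+2} (distinct vertices, at least three).
Acyclic : Graph → Set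
Acyclic G = ∀ k (c : Fin (suc (suc (suc k))) → Vertex G) → Injective _≡_ _≡_ c →
  (∀ (i : Fin (suc (suc k))) → adj G (c (inject₁ i)) (c (suc i)) ≡ true) →
  adj G (c (fromℕ (suc (suc k)))) (c zero) ≡ true → ⊥

IsTree : Graph → Set
IsTree T = (0 < size T) × ConnectedSet T S.⊤ × Acyclic T

Leaf : (T : Graph) → Vertex T → Set
Leaf T t = ∀ u w → adj T t u ≡ true → adj T t w ≡ true → u ≡ w

record TreeDecomposition (G : Graph) : Set where
  field
    tree    : Graph
    isTree  : IsTree tree
    leafOf  : Edge G → Vertex tree
    leafInj : Injective _≡_ _≡_ leafOf
    isLeaf  : ∀ e → Leaf tree (leafOf e)
open TreeDecomposition public

-- t ∈ V(T_v): t lies in every subtree of T containing all leaves that are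
-- edges incident with v (T_v = minimal such subtree = their intersection).
InTv : {G : Graph} (D : TreeDecomposition G) → Vertex G → Vertex (tree D) → Set
InTv {G} D v t = (X : Subset (size (tree D))) → ConnectedSet (tree D) X →
  (∀ e → Incident G v e → leafOf D e ∈ X) → t ∈ X

Bag : {G : Graph} (D : TreeDecomposition G) → Vertex (tree D) → Vertex G → Set
Bag D t v = InTv D v t

AtLeast : {n : ℕ} → (Fin n → Set) → ℕ → Set
AtLeast {n} P k = Σ (Fin k → Fin n) λ f → Injective _≡_ _≡_ f × (∀ i → P (f i))

SizeBelow : {n : ℕ} → (Fin n → Set) → ℕ → Set
SizeBelow {n} P k = ∀ j (f : Fin j → Fin n) → Injective _≡_ _≡_ f → (∀ i → P (f i)) → j < k

AdhesionBelow : {G : Graph} → TreeDecomposition G → ℕ → Set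
AdhesionBelow D θ = ∀ t t' → adj (tree D) t t' ≡ true →
  SizeBelow (λ v → Bag D t v × Bag D t' v) θ

WidthAtLeast : {G : Graph} → TreeDecomposition G → ℕ → Set
WidthAtLeast D n = ∃ λ t → AtLeast (Bag D t) (suc n)

TreeWidthAtLeast : ℕ → Graph → ℕ → Set
TreeWidthAtLeast θ G n = (D : TreeDecomposition G) → AdhesionBelow D θ → WidthAtLeast D n

-- Let K = θ − 1 and let D be a tree-decomposition of adhesion at most K. Each edge tc of the tree
-- separates the edges of G whose leaves lie in the branch of c at t from the rest, with separator inside
-- Y_t ∩ Y_c. As U is θ-connected and |U| > 3K, at most one side of such a separation carries more than K
-- vertices of U, so following heavy branches ends at a node t all of whose branches are light.
-- A vertex u ∈ U outside Y_t is attached to Y_t through the separator S_u of its branch, a set of at most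
-- K vertices of Y_t. For X ⊆ Y_t with |X| ≤ K the union of the branches whose separators lie in X is a
-- light separation of order at most |X|, so at most |X ∖ U| vertices u have S_u ⊆ X. Double counting
-- over the K-subsets of Y_t gives |U| ≤ |U ∩ Y_t| + |Y_t ∖ U|·C(|Y_t| − 1, K − 1) ≤ K·C(|Y_t|, K),
-- which forces |Y_t| > n.

module Submission where

open import Defs
open import Data.Nat using (ℕ; zero; suc; _+_; _*_; _∸_; _≤_; _<_; _≤?_; _<?_; z≤n; s≤s; _≤′_; ≤′-refl; ≤′-step; >-nonZero)
open import Data.Nat.Properties using (≤-trans; ≤-reflexive; ≤-antisym; +-suc; +-comm; n≤1+n; ≤-pred; +-monoʳ-≤; <-irrefl; m≤m+n; m≤n+m; ≤⇒≤′; ≤-refl; *-zeroʳ; +-identityʳ; *-identityʳ; *-distribˡ-+; +-assoc; m+n∸n≡m; module ≤-Reasoning; +-mono-≤; +-monoˡ-≤; *-monoˡ-≤; *-monoʳ-≤; m≤n⇒m<n∨m≡n; suc-injective; <⇒≱; ⊓-pres-m<; ≰⇒>; ≤-<-trans; <⇒≤; +-cancelʳ-≤; m≤m*n; *-distribʳ-+; *-comm)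
open import Data.Nat.Combinatorics using (_C_; nCk+nC[k+1]≡[n+1]C[k+1]; nCn≡1; nC1≡n; nCk≡nC[n∸k])
open import Data.Nat.Tactic.RingSolver using (solve-∀)
open import Data.Fin using (Fin; zero; suc; inject₁; fromℕ; fromℕ<; inject≤; toℕ; _≟_)
open import Data.Fin.Properties using (any?; all?; ¬∀⟶∃¬; <-cmp; <-irrelevant; toℕ-injective; toℕ-fromℕ<; toℕ<n; inject≤-injective)
open import Data.Fin.Subset using (Subset; inside; outside; _∈_; _∉_; _⊆_; _∪_; _∩_; _─_; _-_; ∁; ⁅_⁆; ⊥; ∣_∣; Nonempty; Empty)
open import Data.Fin.Subset.Properties using (p⊆q⇒∣p∣≤∣q∣; x∈p∪q⁺; x∈p∪q⁻; Empty-unique; ∣⊥∣≡0; nonempty?; x∈p⇒∣p-x∣<∣p∣; x∈⁅x⁆; x∈⁅y⁆⇒x≡y; ∣⁅x⁆∣≡1; _∈?_; _⊆?_; x∈p∩q⁺; x∈p∩q⁻; ∉⊥; x∈p∧x≢y⇒x∈p-y; p─q⊆p; ∈⊤; p⊂q⇒∣p∣<∣q∣; ∣p∩q∣≤∣q∣; ∣p∣≤n; x∉p⇒x∈∁p; x∈∁p⇒x∉p)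
open import Data.Vec using ([]; _∷_)
open import Data.Vec.Base using (_[_]=_)
open import Data.Bool using (Bool; true; false)
import Data.Bool.Properties as Bool
open import Data.Product using (Σ; _×_; _,_; proj₁; proj₂; ∃)
open import Data.Sum using (_⊎_; inj₁; inj₂)
open import Data.Empty using (⊥-elim)
import Data.Empty
open import Data.Unit using (⊤; tt)
open import Level using (0ℓ)
open import Relation.Nullary using (¬_; Dec; yes; no)
open import Relation.Nullary.Decidable using (⌊_⌋; _×-dec_; _⊎-dec_; _→-dec_; ¬?)
open import Relation.Unary using (Pred; Decidable)
open import Relation.Binary.Definitions using (tri<; tri≈; tri>)
open import Relation.Binary.PropositionalEquality using (_≡_; _≢_; refl; sym; trans; cong; cong₂; subst; module ≡-Reasoning)
open import Axiom.UniquenessOfIdentityProofs using (module Decidable⇒UIP)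
open import Function using (_∘_)
open import Function.Definitions using (Injective)
open _[_]=_

private
  variable
    m : ℕ

⟦_⟧ : {P : Pred (Fin m) 0ℓ} → Decidable P → Subset m
⟦_⟧ {zero} P? = []
⟦_⟧ {suc m} P? = ⌊ P? zero ⌋ ∷ ⟦ (λ x → P? (suc x)) ⟧

∈⟦⟧⁺ : {P : Pred (Fin m) 0ℓ} (P? : Decidable P) {x : Fin m} → P x → x ∈ ⟦ P? ⟧
∈⟦⟧⁺ P? {zero} px with P? zero
... | yes _ = here
... | no ¬px = ⊥-elim (¬px px)
∈⟦⟧⁺ P? {suc x} px = there (∈⟦⟧⁺ (λ y → P? (suc y)) px)

∈⟦⟧⁻ : {P : Pred (Fin m) 0ℓ} (P? : Decidable P) {x : Fin m} → x ∈ ⟦ P? ⟧ → P x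
∈⟦⟧⁻ P? {zero} x∈ with P? zero | x∈
... | yes px | _ = px
∈⟦⟧⁻ P? {suc x} (there x∈) = ∈⟦⟧⁻ (λ y → P? (suc y)) x∈

∣p∪q∣≤∣p∣+∣q∣ : (p q : Subset m) → ∣ p ∪ q ∣ ≤ ∣ p ∣ + ∣ q ∣
∣p∪q∣≤∣p∣+∣q∣ [] [] = z≤n
∣p∪q∣≤∣p∣+∣q∣ (inside ∷ p) (inside ∷ q) = s≤s (≤-trans (∣p∪q∣≤∣p∣+∣q∣ p q) (+-monoʳ-≤ ∣ p ∣ (n≤1+n ∣ q ∣)))
∣p∪q∣≤∣p∣+∣q∣ (inside ∷ p) (outside ∷ q) = s≤s (∣p∪q∣≤∣p∣+∣q∣ p q)
∣p∪q∣≤∣p∣+∣q∣ (outside ∷ p) (inside ∷ q) = ≤-trans (s≤s (∣p∪q∣≤∣p∣+∣q∣ p q)) (≤-reflexive (sym (+-suc ∣ p ∣ ∣ q ∣)))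
∣p∪q∣≤∣p∣+∣q∣ (outside ∷ p) (outside ∷ q) = ∣p∪q∣≤∣p∣+∣q∣ p q

Disjoint : Subset m → Subset m → Set
Disjoint p q = ∀ {x} → x ∈ p → x ∉ q

∣p∪q∣≡∣p∣+∣q∣ : (p q : Subset m) → Disjoint p q → ∣ p ∪ q ∣ ≡ ∣ p ∣ + ∣ q ∣
∣p∪q∣≡∣p∣+∣q∣ [] [] _ = refl
∣p∪q∣≡∣p∣+∣q∣ (inside ∷ p) (inside ∷ q) p#q = ⊥-elim (p#q here here)
∣p∪q∣≡∣p∣+∣q∣ (inside ∷ p) (outside ∷ q) p#q = cong suc (∣p∪q∣≡∣p∣+∣q∣ p q (λ x∈p x∈q → p#q (there x∈p) (there x∈q)))
∣p∪q∣≡∣p∣+∣q∣ (outside ∷ p) (inside ∷ q) p#q =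
  trans (cong suc (∣p∪q∣≡∣p∣+∣q∣ p q (λ x∈p x∈q → p#q (there x∈p) (there x∈q)))) (sym (+-suc ∣ p ∣ ∣ q ∣))
∣p∪q∣≡∣p∣+∣q∣ (outside ∷ p) (outside ∷ q) p#q = ∣p∪q∣≡∣p∣+∣q∣ p q (λ x∈p x∈q → p#q (there x∈p) (there x∈q))

covered⇒∣r∣≤∣p∣+∣q∣ : {p q r : Subset m} → (∀ {x} → x ∈ r → x ∈ p ⊎ x ∈ q) → ∣ r ∣ ≤ ∣ p ∣ + ∣ q ∣
covered⇒∣r∣≤∣p∣+∣q∣ {p = p} {q} cover = ≤-trans (p⊆q⇒∣p∣≤∣q∣ (λ x∈r → x∈p∪q⁺ (cover x∈r))) (∣p∪q∣≤∣p∣+∣q∣ p q)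

disjoint⇒∣p∣+∣q∣≤∣r∣ : {p q r : Subset m} → Disjoint p q → p ⊆ r → q ⊆ r → ∣ p ∣ + ∣ q ∣ ≤ ∣ r ∣
disjoint⇒∣p∣+∣q∣≤∣r∣ {p = p} {q} {r} p#q p⊆r q⊆r =
  ≤-trans (≤-reflexive (sym (∣p∪q∣≡∣p∣+∣q∣ p q p#q))) (p⊆q⇒∣p∣≤∣q∣ p∪q⊆r)
  where
  p∪q⊆r : p ∪ q ⊆ r
  p∪q⊆r x∈ with x∈p∪q⁻ p q x∈
  ... | inj₁ x∈p = p⊆r x∈p
  ... | inj₂ x∈q = q⊆r x∈q

Empty⇒∣p∣≡0 : {p : Subset m} → Empty p → ∣ p ∣ ≡ 0
Empty⇒∣p∣≡0 {m} p-empty = trans (cong ∣_∣ (Empty-unique p-empty)) (∣⊥∣≡0 m)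

∣p∣>0⇒Nonempty : (p : Subset m) → 0 < ∣ p ∣ → Nonempty p
∣p∣>0⇒Nonempty p 0<∣p∣ with nonempty? p
... | yes p≠∅ = p≠∅
... | no p-empty = ⊥-elim (<-irrefl (sym (Empty⇒∣p∣≡0 p-empty)) 0<∣p∣)

x∈p⇒∣p∣>0 : {p : Subset m} {x : Fin m} → x ∈ p → 0 < ∣ p ∣
x∈p⇒∣p∣>0 x∈p = ≤-<-trans z≤n (x∈p⇒∣p-x∣<∣p∣ x∈p)

x∈p─q⇒x∉q : {p q : Subset m} {x : Fin m} → x ∈ p ─ q → x ∉ q
x∈p─q⇒x∉q {p = outside ∷ p} {outside ∷ q} (there x∈) (there x∈q) = x∈p─q⇒x∉q x∈ x∈q
x∈p─q⇒x∉q {p = outside ∷ p} {inside ∷ q} (there x∈) (there x∈q) = x∈p─q⇒x∉q x∈ x∈q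
x∈p─q⇒x∉q {p = inside ∷ p} {outside ∷ q} (there x∈) (there x∈q) = x∈p─q⇒x∉q x∈ x∈q
x∈p─q⇒x∉q {p = inside ∷ p} {inside ∷ q} (there x∈) (there x∈q) = x∈p─q⇒x∉q x∈ x∈q
x∈p─q⇒x∉q {p = inside ∷ p} {outside ∷ q} here ()

x∈p-y⇒x≢y : {p : Subset m} {x y : Fin m} → x ∈ p - y → x ≢ y
x∈p-y⇒x≢y {y = y} x∈ refl = x∈p─q⇒x∉q x∈ (x∈⁅x⁆ y)

x∈p⇒1+∣p-x∣≡∣p∣ : {p : Subset m} {x : Fin m} → x ∈ p → suc ∣ p - x ∣ ≡ ∣ p ∣
x∈p⇒1+∣p-x∣≡∣p∣ {p = p} {x} x∈p = ≤-antisym (x∈p⇒∣p-x∣<∣p∣ x∈p) ∣p∣≤∣p-x∣+1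
  where
  ∣p∣≤∣p-x∣+1 : ∣ p ∣ ≤ suc ∣ p - x ∣
  ∣p∣≤∣p-x∣+1 = ≤-trans (covered⇒∣r∣≤∣p∣+∣q∣ split) (≤-reflexive (trans (cong (∣ p - x ∣ +_) (∣⁅x⁆∣≡1 x)) (+-comm ∣ p - x ∣ 1)))
    where
    split : ∀ {y} → y ∈ p → y ∈ p - x ⊎ y ∈ ⁅ x ⁆
    split {y} y∈p with y ≟ x
    ... | yes refl = inj₂ (x∈⁅x⁆ x)
    ... | no y≢x = inj₁ (x∈p∧x≢y⇒x∈p-y y∈p y≢x)

enumerate : (p : Subset m) → Σ (Fin ∣ p ∣ → Fin m) λ f → Injective _≡_ _≡_ f × (∀ i → f i ∈ p)
enumerate [] = (λ ()) , (λ {}) , (λ ())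
enumerate (inside ∷ p) with enumerate p
... | f , f-inj , f∈p = g , g-inj , g∈
  where
  g : Fin (suc ∣ p ∣) → Fin (suc _)
  g zero = zero
  g (suc i) = suc (f i)
  g-inj : Injective _≡_ _≡_ g
  g-inj {zero} {zero} _ = refl
  g-inj {suc i} {suc j} eq = cong suc (f-inj (Data.Fin.Properties.suc-injective eq))
  g∈ : ∀ i → g i ∈ inside ∷ p
  g∈ zero = here
  g∈ (suc i) = there (f∈p i)
enumerate (outside ∷ p) with enumerate p
... | f , f-inj , f∈p = (λ i → suc (f i)) , (λ eq → f-inj (Data.Fin.Properties.suc-injective eq)) , (λ i → there (f∈p i))

nCk>0 : ∀ {n k} → k ≤ n → 0 < n C k
nCk>0 {n} {zero} _ = s≤s z≤n
nCk>0 {suc n} {suc k} (s≤s k≤n) = begin-strict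
  0                    <⟨ nCk>0 k≤n ⟩
  n C k                ≤⟨ m≤m+n (n C k) (n C suc k) ⟩
  n C k + n C suc k    ≡⟨ nCk+nC[k+1]≡[n+1]C[k+1] n k ⟩
  suc n C suc k        ∎
  where open ≤-Reasoning

nCk≤[1+n]Ck : ∀ n k → n C k ≤ suc n C k
nCk≤[1+n]Ck n zero = ≤-refl
nCk≤[1+n]Ck n (suc k) = ≤-trans (m≤n+m (n C suc k) (n C k)) (≤-reflexive (nCk+nC[k+1]≡[n+1]C[k+1] n k))

C-monoˡ-≤ : ∀ {m n} k → m ≤ n → m C k ≤ n C k
C-monoˡ-≤ {m} k m≤n = go (≤⇒≤′ m≤n)
  where
  go : ∀ {n} → m ≤′ n → m C k ≤ n C k
  go ≤′-refl = ≤-refl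
  go (≤′-step {n} m≤′n) = ≤-trans (go m≤′n) (nCk≤[1+n]Ck n k)

[1+k]*[1+n]C[1+k]≡[1+n]*nCk : ∀ n k → suc k * (suc n C suc k) ≡ suc n * (n C k)
[1+k]*[1+n]C[1+k]≡[1+n]*nCk zero zero = refl
[1+k]*[1+n]C[1+k]≡[1+n]*nCk zero (suc k) = *-zeroʳ (suc (suc k))
[1+k]*[1+n]C[1+k]≡[1+n]*nCk (suc n) zero = trans (+-identityʳ _) (trans (nC1≡n (suc (suc n))) (sym (*-identityʳ (suc (suc n)))))
[1+k]*[1+n]C[1+k]≡[1+n]*nCk (suc n) (suc k) = begin
  suc (suc k) * (suc (suc n) C suc (suc k))
    ≡⟨ cong (suc (suc k) *_) (sym (nCk+nC[k+1]≡[n+1]C[k+1] (suc n) (suc k))) ⟩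
  suc (suc k) * (suc n C suc k + suc n C suc (suc k))
    ≡⟨ *-distribˡ-+ (suc (suc k)) (suc n C suc k) (suc n C suc (suc k)) ⟩
  suc n C suc k + suc k * (suc n C suc k) + suc (suc k) * (suc n C suc (suc k))
    ≡⟨ cong₂ (λ a b → suc n C suc k + a + b) ([1+k]*[1+n]C[1+k]≡[1+n]*nCk n k) ([1+k]*[1+n]C[1+k]≡[1+n]*nCk n (suc k)) ⟩
  suc n C suc k + suc n * (n C k) + suc n * (n C suc k)
    ≡⟨ +-assoc (suc n C suc k) (suc n * (n C k)) (suc n * (n C suc k)) ⟩
  suc n C suc k + (suc n * (n C k) + suc n * (n C suc k))
    ≡⟨ cong (suc n C suc k +_) (sym (*-distribˡ-+ (suc n) (n C k) (n C suc k))) ⟩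
  suc n C suc k + suc n * (n C k + n C suc k)
    ≡⟨ cong (λ c → suc n C suc k + suc n * c) (nCk+nC[k+1]≡[n+1]C[k+1] n k) ⟩
  suc (suc n) * (suc n C suc k)
    ∎
  where open ≡-Reasoning

k<n⇒1+k≤nCk : ∀ {n k} → k < n → suc k ≤ n C k
k<n⇒1+k≤nCk {n} {k} k<n = begin
  suc k            ≡⟨ nC1≡n (suc k) ⟨
  suc k C 1        ≡⟨ cong (suc k C_) (sym (m+n∸n≡m 1 k)) ⟩
  suc k C (suc k ∸ k) ≡⟨ nCk≡nC[n∸k] (n≤1+n k) ⟨
  suc k C k        ≤⟨ C-monoˡ-≤ k k<n ⟩
  n C k            ∎
  where open ≤-Reasoning

n≤k*nCk : ∀ {n k} → 0 < k → k ≤ n → n ≤ k * (n C k)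
n≤k*nCk {suc n} {suc k} _ (s≤s k≤n) = begin
  suc n                     ≡⟨ *-identityʳ (suc n) ⟨
  suc n * 1                 ≤⟨ *-monoʳ-≤ (suc n) (nCk>0 k≤n) ⟩
  suc n * (n C k)           ≡⟨ [1+k]*[1+n]C[1+k]≡[1+n]*nCk n k ⟨
  suc k * (suc n C suc k)   ∎
  where open ≤-Reasoning

-- z·C(w−1, k−1) + d·C(w, k); k = 0 is separate because there C(w−1, k−1) must vanish, while k ∸ 1 = 0.
bound : ℕ → ℕ → ℕ → ℕ → ℕ
bound zero w z d = d
bound (suc j) w z d = z * ((w ∸ 1) C j) + d * (w C suc j)

bound-step : ∀ j w z′ e z d a₁ a₂ → suc j ≤ w → z′ + e ≤ z →
             a₁ ≤ bound (suc j) w z′ d → a₂ ≤ bound j w z′ (d + e) → a₁ + a₂ ≤ bound (suc j) (suc w) z d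
bound-step zero w z′ e z d a₁ a₂ _ z′+e≤z a₁≤ a₂≤ = begin
  a₁ + a₂                                  ≤⟨ +-mono-≤ a₁≤ a₂≤ ⟩
  (z′ * 1 + d * (w C 1)) + (d + e)         ≡⟨ cong (λ c → (z′ * 1 + d * c) + (d + e)) (nC1≡n w) ⟩
  (z′ * 1 + d * w) + (d + e)               ≡⟨ identity z′ e d w ⟩
  (z′ + e) * 1 + d * suc w                 ≤⟨ +-monoˡ-≤ (d * suc w) (*-monoˡ-≤ 1 z′+e≤z) ⟩
  z * 1 + d * suc w                        ≡⟨ cong (λ c → z * 1 + d * c) (nC1≡n (suc w)) ⟨
  z * 1 + d * (suc w C 1)                  ∎
  where
  open ≤-Reasoning
  identity : ∀ z′ e d w → (z′ * 1 + d * w) + (d + e) ≡ (z′ + e) * 1 + d * suc w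
  identity = solve-∀
bound-step (suc i) (suc w) z′ e z d a₁ a₂ _ z′+e≤z a₁≤ a₂≤ = begin
  a₁ + a₂
    ≤⟨ +-mono-≤ a₁≤ a₂≤ ⟩
  (z′ * q + d * s) + (z′ * p + (d + e) * (suc w C suc i))
    ≡⟨ cong (λ c → (z′ * q + d * s) + (z′ * p + (d + e) * c)) (sym pascal₁) ⟩
  (z′ * q + d * s) + (z′ * p + (d + e) * (p + q))
    ≡⟨ identity z′ e d p q s ⟩
  (z′ + e) * (p + q) + d * ((p + q) + s)
    ≤⟨ +-monoˡ-≤ (d * ((p + q) + s)) (*-monoˡ-≤ (p + q) z′+e≤z) ⟩
  z * (p + q) + d * ((p + q) + s)
    ≡⟨ cong₂ (λ c c′ → z * c + d * c′) pascal₁ (trans (cong (_+ s) pascal₁) (nCk+nC[k+1]≡[n+1]C[k+1] (suc w) (suc i))) ⟩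
  z * (suc w C suc i) + d * (suc (suc w) C suc (suc i))
    ∎
  where
  open ≤-Reasoning
  p = w C i
  q = w C suc i
  s = suc w C suc (suc i)
  pascal₁ = nCk+nC[k+1]≡[n+1]C[k+1] w i
  identity : ∀ z′ e d p q s → (z′ * q + d * s) + (z′ * p + (d + e) * (p + q)) ≡ (z′ + e) * (p + q) + d * ((p + q) + s)
  identity = solve-∀

module _ {ι m : ℕ} (Z : Subset m) where

  selected : Subset ι → (Fin ι → Subset m) → Subset m → Subset ι
  selected F S X = ⟦ (λ u → u ∈? F ×-dec S u ⊆? X) ⟧

  Bounded : ℕ → Subset m → Subset ι → (Fin ι → Subset m) → Set
  Bounded k W F S = ∀ {u} → u ∈ F → S u ⊆ W × ∣ S u ∣ ≤ k

  Sparse : ℕ → Subset m → Subset ι → (Fin ι → Subset m) → ℕ → Set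
  Sparse k W F S d = ∀ X → X ⊆ W → ∣ X ∣ ≤ k → ∣ selected F S X ∣ ≤ ∣ X ∩ Z ∣ + d

  all-selected : ∀ {k W F S} X → Bounded k W F S → W ⊆ X → F ⊆ selected F S X
  all-selected X bdd W⊆X u∈F = ∈⟦⟧⁺ _ (u∈F , λ {_} y∈ → W⊆X (proj₁ (bdd u∈F) y∈))

  module Split (x : Fin m) (F : Subset ι) (S : Fin ι → Subset m) where

    avoiding through : Subset ι
    avoiding = ⟦ (λ u → u ∈? F ×-dec ¬? (x ∈? S u)) ⟧
    through = ⟦ (λ u → u ∈? F ×-dec x ∈? S u) ⟧

    S-x : Fin ι → Subset m
    S-x u = S u - x

    ∣F∣≤∣avoiding∣+∣through∣ : ∣ F ∣ ≤ ∣ avoiding ∣ + ∣ through ∣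
    ∣F∣≤∣avoiding∣+∣through∣ = covered⇒∣r∣≤∣p∣+∣q∣ side
      where
      side : ∀ {u} → u ∈ F → u ∈ avoiding ⊎ u ∈ through
      side {u} u∈F with x ∈? S u
      ... | yes x∈Su = inj₂ (∈⟦⟧⁺ _ (u∈F , x∈Su))
      ... | no x∉Su = inj₁ (∈⟦⟧⁺ _ (u∈F , x∉Su))

    bounded-avoiding : ∀ {k W} → Bounded k W F S → Bounded k (W - x) avoiding S
    bounded-avoiding bdd u∈ with ∈⟦⟧⁻ _ u∈
    ... | u∈F , x∉Su = (λ {y} y∈Su → x∈p∧x≢y⇒x∈p-y (proj₁ (bdd u∈F) y∈Su) λ { refl → x∉Su y∈Su }) , proj₂ (bdd u∈F)

    sparse-avoiding : ∀ {k W d} → Sparse k W F S d → Sparse k (W - x) avoiding S d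
    sparse-avoiding {W = W} sparse X X⊆W-x ∣X∣≤k =
      ≤-trans (p⊆q⇒∣p∣≤∣q∣ sel⊆sel) (sparse X (λ y∈ → p─q⊆p W ⁅ x ⁆ (X⊆W-x y∈)) ∣X∣≤k)
      where
      sel⊆sel : selected avoiding S X ⊆ selected F S X
      sel⊆sel u∈ with ∈⟦⟧⁻ _ u∈
      ... | u∈avoiding , Su⊆X = ∈⟦⟧⁺ _ (proj₁ (∈⟦⟧⁻ _ u∈avoiding) , λ {y} → Su⊆X {y})

    bounded-through : ∀ {j W} → Bounded (suc j) W F S → Bounded j (W - x) through S-x
    bounded-through {W = W} bdd {u} u∈ with ∈⟦⟧⁻ _ u∈
    ... | u∈F , x∈Su = Su-x⊆W-x , ≤-pred (≤-trans (≤-reflexive (x∈p⇒1+∣p-x∣≡∣p∣ x∈Su)) (proj₂ (bdd u∈F)))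
      where
      Su-x⊆W-x : S u - x ⊆ W - x
      Su-x⊆W-x y∈ = x∈p∧x≢y⇒x∈p-y (proj₁ (bdd u∈F) (p─q⊆p (S u) ⁅ x ⁆ y∈)) (x∈p-y⇒x≢y y∈)

    sparse-through : ∀ {j W d} → x ∈ W → Sparse (suc j) W F S d → Sparse j (W - x) through S-x (d + ∣ ⁅ x ⁆ ∩ Z ∣)
    sparse-through {j} {W} {d} x∈W sparse X X⊆W-x ∣X∣≤j = begin
      ∣ selected through S-x X ∣                ≤⟨ p⊆q⇒∣p∣≤∣q∣ sel⊆sel ⟩
      ∣ selected F S (X ∪ ⁅ x ⁆) ∣               ≤⟨ sparse (X ∪ ⁅ x ⁆) X+x⊆W ∣X+x∣≤1+j ⟩
      ∣ (X ∪ ⁅ x ⁆) ∩ Z ∣ + d                    ≤⟨ +-monoˡ-≤ d (covered⇒∣r∣≤∣p∣+∣q∣ split∩Z) ⟩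
      ∣ X ∩ Z ∣ + ∣ ⁅ x ⁆ ∩ Z ∣ + d              ≡⟨ +-assoc ∣ X ∩ Z ∣ _ d ⟩
      ∣ X ∩ Z ∣ + (∣ ⁅ x ⁆ ∩ Z ∣ + d)            ≡⟨ cong (∣ X ∩ Z ∣ +_) (+-comm _ d) ⟩
      ∣ X ∩ Z ∣ + (d + ∣ ⁅ x ⁆ ∩ Z ∣)            ∎
      where
      open ≤-Reasoning
      X+x⊆W : X ∪ ⁅ x ⁆ ⊆ W
      X+x⊆W y∈ with x∈p∪q⁻ X ⁅ x ⁆ y∈
      ... | inj₁ y∈X = p─q⊆p W ⁅ x ⁆ (X⊆W-x y∈X)
      ... | inj₂ y∈x = subst (_∈ W) (sym (x∈⁅y⁆⇒x≡y x y∈x)) x∈W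
      ∣X+x∣≤1+j : ∣ X ∪ ⁅ x ⁆ ∣ ≤ suc j
      ∣X+x∣≤1+j = ≤-trans (∣p∪q∣≤∣p∣+∣q∣ X ⁅ x ⁆) (≤-trans (+-monoʳ-≤ ∣ X ∣ (≤-reflexive (∣⁅x⁆∣≡1 x)))
                    (≤-trans (≤-reflexive (+-comm ∣ X ∣ 1)) (s≤s ∣X∣≤j)))
      split∩Z : ∀ {y} → y ∈ (X ∪ ⁅ x ⁆) ∩ Z → y ∈ X ∩ Z ⊎ y ∈ ⁅ x ⁆ ∩ Z
      split∩Z y∈ with x∈p∩q⁻ (X ∪ ⁅ x ⁆) Z y∈
      ... | y∈X+x , y∈Z with x∈p∪q⁻ X ⁅ x ⁆ y∈X+x
      ... | inj₁ y∈X = inj₁ (x∈p∩q⁺ (y∈X , y∈Z))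
      ... | inj₂ y∈x = inj₂ (x∈p∩q⁺ (y∈x , y∈Z))
      sel⊆sel : selected through S-x X ⊆ selected F S (X ∪ ⁅ x ⁆)
      sel⊆sel {u} u∈ with ∈⟦⟧⁻ _ u∈
      ... | u∈through , Su-x⊆X = ∈⟦⟧⁺ _ (proj₁ (∈⟦⟧⁻ _ u∈through) , λ {y} → Su⊆X+x {y})
        where
        Su⊆X+x : S u ⊆ X ∪ ⁅ x ⁆
        Su⊆X+x {y} y∈Su with y ≟ x
        ... | yes refl = x∈p∪q⁺ (inj₂ (x∈⁅x⁆ x))
        ... | no y≢x = x∈p∪q⁺ (inj₁ (Su-x⊆X (x∈p∧x≢y⇒x∈p-y y∈Su y≢x)))

  ∣W-x∩Z∣+∣x∩Z∣≤∣W∩Z∣ : ∀ {W x} → x ∈ W → ∣ (W - x) ∩ Z ∣ + ∣ ⁅ x ⁆ ∩ Z ∣ ≤ ∣ W ∩ Z ∣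
  ∣W-x∩Z∣+∣x∩Z∣≤∣W∩Z∣ {W} {x} x∈W = disjoint⇒∣p∣+∣q∣≤∣r∣ disjoint W-x∩Z⊆W∩Z x∩Z⊆W∩Z
    where
    disjoint : Disjoint ((W - x) ∩ Z) (⁅ x ⁆ ∩ Z)
    disjoint y∈₁ y∈₂ = x∈p-y⇒x≢y (proj₁ (x∈p∩q⁻ _ Z y∈₁)) (x∈⁅y⁆⇒x≡y x (proj₁ (x∈p∩q⁻ _ Z y∈₂)))
    W-x∩Z⊆W∩Z : (W - x) ∩ Z ⊆ W ∩ Z
    W-x∩Z⊆W∩Z y∈ with x∈p∩q⁻ (W - x) Z y∈
    ... | y∈W-x , y∈Z = x∈p∩q⁺ (p─q⊆p W ⁅ x ⁆ y∈W-x , y∈Z)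
    x∩Z⊆W∩Z : ⁅ x ⁆ ∩ Z ⊆ W ∩ Z
    x∩Z⊆W∩Z y∈ with x∈p∩q⁻ ⁅ x ⁆ Z y∈
    ... | y∈x , y∈Z = x∈p∩q⁺ (subst (_∈ W) (sym (x∈⁅y⁆⇒x≡y x y∈x)) x∈W , y∈Z)

  -- Double counting over the k-subsets of W, organised as an induction removing a point x of W: the members
  -- with x ∉ S u keep k and d, those with x ∈ S u drop to k − 1 with slack d + |{x} ∩ Z|.
  count-bound : ∀ k w {W} → ∣ W ∣ ≡ w → k ≤ w → ∀ {F S} d → Bounded k W F S → Sparse k W F S d →
                ∣ F ∣ ≤ bound k w ∣ W ∩ Z ∣ d
  count-bound zero w _ _ {F} {S} d bdd sparse = begin
    ∣ F ∣                  ≤⟨ p⊆q⇒∣p∣≤∣q∣ (all-selected ⊥ bdd′ (λ y∈ → y∈)) ⟩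
    ∣ selected F S ⊥ ∣      ≤⟨ sparse ⊥ (λ y∈ → ⊥-elim (∉⊥ y∈)) (≤-reflexive (∣⊥∣≡0 m)) ⟩
    ∣ ⊥ ∩ Z ∣ + d           ≡⟨ cong (_+ d) (Empty⇒∣p∣≡0 λ (y , y∈) → ∉⊥ (proj₁ (x∈p∩q⁻ ⊥ Z y∈))) ⟩
    d                       ∎
    where
    open ≤-Reasoning
    bdd′ : Bounded zero ⊥ F S
    bdd′ u∈F = (λ y∈Su → ⊥-elim (<-irrefl refl (≤-trans (x∈p⇒∣p∣>0 y∈Su) (proj₂ (bdd u∈F))))) , proj₂ (bdd u∈F)
  count-bound (suc j) w {W} ∣W∣≡w k≤w {F} {S} d bdd sparse with m≤n⇒m<n∨m≡n k≤w
  ... | inj₂ refl = begin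
    ∣ F ∣                             ≤⟨ p⊆q⇒∣p∣≤∣q∣ (all-selected W bdd (λ y∈ → y∈)) ⟩
    ∣ selected F S W ∣                 ≤⟨ sparse W (λ y∈ → y∈) (≤-reflexive ∣W∣≡w) ⟩
    ∣ W ∩ Z ∣ + d                      ≡⟨ cong₂ _+_ (sym (*-identityʳ _)) (sym (*-identityʳ d)) ⟩
    ∣ W ∩ Z ∣ * 1 + d * 1              ≡⟨ cong₂ (λ c c′ → ∣ W ∩ Z ∣ * c + d * c′) (sym (nCn≡1 j)) (sym (nCn≡1 (suc j))) ⟩
    bound (suc j) (suc j) ∣ W ∩ Z ∣ d  ∎
    where open ≤-Reasoning
  ... | inj₁ (s≤s {n = w′} k≤w′) = begin
    ∣ F ∣                              ≤⟨ ∣F∣≤∣avoiding∣+∣through∣ ⟩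
    ∣ avoiding ∣ + ∣ through ∣          ≤⟨ bound-step j w′ _ _ _ d _ _ k≤w′ (∣W-x∩Z∣+∣x∩Z∣≤∣W∩Z∣ x∈W) IH₁ IH₂ ⟩
    bound (suc j) (suc w′) ∣ W ∩ Z ∣ d  ∎
    where
    open ≤-Reasoning
    W-nonempty = ∣p∣>0⇒Nonempty W (subst (0 <_) (sym ∣W∣≡w) (s≤s z≤n))
    x = proj₁ W-nonempty
    x∈W = proj₂ W-nonempty
    open Split x F S
    ∣W-x∣≡w′ : ∣ W - x ∣ ≡ w′
    ∣W-x∣≡w′ = suc-injective (trans (x∈p⇒1+∣p-x∣≡∣p∣ x∈W) ∣W∣≡w)
    IH₁ = count-bound (suc j) w′ ∣W-x∣≡w′ k≤w′ d (bounded-avoiding bdd) (sparse-avoiding sparse)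
    IH₂ = count-bound j w′ ∣W-x∣≡w′ (≤-trans (n≤1+n j) k≤w′) (d + _) (bounded-through bdd) (sparse-through x∈W sparse)

a+bound≤k*nCk : ∀ k {a z w n} → 0 < k → a + z ≤ w → k ≤ w → w ≤ n → a + bound k w z 0 ≤ k * (n C k)
a+bound≤k*nCk (suc j) {a} {z} {suc w} {n} _ a+z≤w (s≤s j≤w) w≤n = begin
  a + (z * (w C j) + 0 * (suc w C suc j))  ≡⟨ cong (a +_) (+-identityʳ (z * (w C j))) ⟩
  a + z * (w C j)                         ≤⟨ +-monoˡ-≤ (z * (w C j)) (m≤m*n a (w C j) {{>-nonZero (nCk>0 j≤w)}}) ⟩
  a * (w C j) + z * (w C j)               ≡⟨ *-distribʳ-+ (w C j) a z ⟨
  (a + z) * (w C j)                       ≤⟨ *-monoˡ-≤ (w C j) a+z≤w ⟩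
  suc w * (w C j)                         ≡⟨ [1+k]*[1+n]C[1+k]≡[1+n]*nCk w j ⟨
  suc j * (suc w C suc j)                 ≤⟨ *-monoʳ-≤ (suc j) (C-monoˡ-≤ (suc j) w≤n) ⟩
  suc j * (n C suc j)                     ∎
  where open ≤-Reasoning

module Walks (G : Graph) where

  infixr 5 _∷⟨_⟩_

  data Walk (P : Vertex G → Set) : Vertex G → Vertex G → Set where
    [_]    : ∀ {x} → P x → Walk P x x
    _∷⟨_⟩_ : ∀ {x y z} → P x → adj G x y ≡ true → Walk P y z → Walk P x z

  private
    variable
      P Q : Vertex G → Set
      x y z : Vertex G

  adj-sym : adj G x y ≡ true → adj G y x ≡ true
  adj-sym {x} {y} e = trans (symm G y x) e

  adj⇒≢ : adj G x y ≡ true → x ≢ y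
  adj⇒≢ {x} e refl with trans (sym e) (irrefl G x)
  ... | ()

  fromReach : ∀ {X} → Reach G X x y → Walk (_∈ X) x y
  fromReach (here x∈X) = [ x∈X ]
  fromReach (step x∈X e r) = x∈X ∷⟨ e ⟩ fromReach r

  map : (∀ {v} → P v → Q v) → Walk P x y → Walk Q x y
  map f [ p ] = [ f p ]
  map f (p ∷⟨ e ⟩ w) = f p ∷⟨ e ⟩ map f w

  source : Walk P x y → P x
  source [ p ] = p
  source (p ∷⟨ _ ⟩ _) = p

  target : Walk P x y → P y
  target [ p ] = p
  target (_ ∷⟨ _ ⟩ w) = target w

  infixr 5 _++_

  _++_ : Walk P x y → Walk P y z → Walk P x z
  [ _ ] ++ w′ = w′
  (p ∷⟨ e ⟩ w) ++ w′ = p ∷⟨ e ⟩ (w ++ w′)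

  reverse : Walk P x y → Walk P y x
  reverse [ p ] = [ p ]
  reverse (p ∷⟨ e ⟩ w) = reverse w ++ (source w ∷⟨ adj-sym e ⟩ [ p ])

  cut-at : (t : Vertex G) → Walk P x y → Walk P x t ⊎ Walk (λ v → P v × v ≢ t) x y
  cut-at t ([_] {x} p) with x ≟ t
  ... | yes refl = inj₁ [ p ]
  ... | no x≢t = inj₂ [ p , x≢t ]
  cut-at t (_∷⟨_⟩_ {x} p e w) with x ≟ t
  ... | yes refl = inj₁ [ p ]
  ... | no x≢t with cut-at t w
  ...   | inj₁ w′ = inj₁ (p ∷⟨ e ⟩ w′)
  ...   | inj₂ w′ = inj₂ ((p , x≢t) ∷⟨ e ⟩ w′)

  last-step : Walk P x y → x ≢ y → ∃ λ d → adj G d y ≡ true × Walk (λ v → P v × v ≢ y) x d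
  last-step [ _ ] x≢x = ⊥-elim (x≢x refl)
  last-step {y = y} (_∷⟨_⟩_ {x} {u} p e w) x≢y with u ≟ y
  ... | yes refl = x , e , [ p , x≢y ]
  ... | no u≢y with last-step w u≢y
  ...   | d , d-y , w′ = d , d-y , (p , x≢y) ∷⟨ e ⟩ w′

  length : Walk P x y → ℕ
  length [ _ ] = zero
  length (_ ∷⟨ _ ⟩ w) = suc (length w)

  vertex : (w : Walk P x y) → Fin (suc (length w)) → Vertex G
  vertex ([_] {x} _) zero = x
  vertex (_∷⟨_⟩_ {x} _ _ _) zero = x
  vertex (_ ∷⟨ _ ⟩ w) (suc i) = vertex w i

  vertex-P : (w : Walk P x y) (i : Fin (suc (length w))) → P (vertex w i)
  vertex-P [ p ] zero = p
  vertex-P (p ∷⟨ _ ⟩ _) zero = p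
  vertex-P (_ ∷⟨ _ ⟩ w) (suc i) = vertex-P w i

  vertex-zero : (w : Walk P x y) → vertex w zero ≡ x
  vertex-zero [ _ ] = refl
  vertex-zero (_ ∷⟨ _ ⟩ _) = refl

  vertex-last : (w : Walk P x y) → vertex w (fromℕ (length w)) ≡ y
  vertex-last [ _ ] = refl
  vertex-last (_ ∷⟨ _ ⟩ w) = vertex-last w

  vertex-adj : (w : Walk P x y) (i : Fin (length w)) → adj G (vertex w (inject₁ i)) (vertex w (suc i)) ≡ true
  vertex-adj (_ ∷⟨ e ⟩ w) zero = trans (cong (adj G _) (vertex-zero w)) e
  vertex-adj (_ ∷⟨ _ ⟩ w) (suc i) = vertex-adj w i

  IsPath : Walk P x y → Set
  IsPath [ _ ] = ⊤
  IsPath (_∷⟨_⟩_ {x} _ _ w) = (∀ i → vertex w i ≢ x) × IsPath w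

  Path : (Vertex G → Set) → Vertex G → Vertex G → Set
  Path P x y = Σ (Walk P x y) IsPath

  vertex-injective : (w : Walk P x y) → IsPath w → Injective _≡_ _≡_ (vertex w)
  vertex-injective [ _ ] _ {zero} {zero} _ = refl
  vertex-injective (_ ∷⟨ _ ⟩ _) _ {zero} {zero} _ = refl
  vertex-injective (_ ∷⟨ _ ⟩ _) (fresh , _) {zero} {suc j} eq = ⊥-elim (fresh j (sym eq))
  vertex-injective (_ ∷⟨ _ ⟩ _) (fresh , _) {suc i} {zero} eq = ⊥-elim (fresh i eq)
  vertex-injective (_ ∷⟨ _ ⟩ w) (_ , path) {suc i} {suc j} eq = cong suc (vertex-injective w path eq)

  suffix : (w : Walk P x y) → IsPath w → (i : Fin (suc (length w))) → Path P (vertex w i) y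
  suffix [ p ] _ zero = [ p ] , tt
  suffix (p ∷⟨ e ⟩ w) path zero = p ∷⟨ e ⟩ w , path
  suffix (_ ∷⟨ _ ⟩ w) (_ , path) (suc i) = suffix w path i

  to-path : Walk P x y → Path P x y
  to-path [ p ] = [ p ] , tt
  to-path {P = P} {y = y} (_∷⟨_⟩_ {x} p e w) with to-path w
  ... | w′ , path with any? (λ i → vertex w′ i ≟ x)
  ...   | yes (i , revisit) = subst (λ v → Path P v y) revisit (suffix w′ path i)
  ...   | no fresh = p ∷⟨ e ⟩ w′ , (λ i eq → fresh (i , eq)) , path

  -- The two edges t–c and c′–t close a path from c to c′ avoiding t into a cycle.
  acyclic-unique-neighbour : Acyclic G → ∀ {t c c′} → adj G t c ≡ true → adj G t c′ ≡ true →
                             Walk (_≢ t) c c′ → c ≡ c′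
  acyclic-unique-neighbour acyclic {t} {c} {c′} t-c t-c′ w with c ≟ c′
  ... | yes c≡c′ = c≡c′
  ... | no c≢c′ with to-path w
  ...   | [ _ ] , _ = ⊥-elim (c≢c′ refl)
  ...   | p ∷⟨ e ⟩ w′ , path = ⊥-elim (acyclic (length w′) cycle cycle-injective cycle-adj cycle-closed)
    where
    π = p ∷⟨ e ⟩ w′
    cycle : Fin (suc (suc (suc (length w′)))) → Vertex G
    cycle zero = t
    cycle (suc i) = vertex π i
    cycle-injective : Injective _≡_ _≡_ cycle
    cycle-injective {zero} {zero} _ = refl
    cycle-injective {zero} {suc j} eq = ⊥-elim (vertex-P π j (sym eq))
    cycle-injective {suc i} {zero} eq = ⊥-elim (vertex-P π i eq)
    cycle-injective {suc i} {suc j} eq = cong suc (vertex-injective π path eq)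
    cycle-adj : ∀ (i : Fin (suc (suc (length w′)))) → adj G (cycle (inject₁ i)) (cycle (suc i)) ≡ true
    cycle-adj zero = t-c
    cycle-adj (suc i) = vertex-adj π i
    cycle-closed : adj G (cycle (fromℕ (suc (suc (length w′))))) (cycle zero) ≡ true
    cycle-closed = trans (cong (λ v → adj G v t) (vertex-last π)) (adj-sym t-c′)

module Branches (T : Graph) (T-tree : IsTree T) where

  open Walks T public

  private
    variable
      t c x y : Vertex T

    connected : ConnectedSet T Data.Fin.Subset.⊤
    connected = proj₁ (proj₂ T-tree)

    acyclic : Acyclic T
    acyclic = proj₂ (proj₂ T-tree)

  last-exit : ∀ {P} t → Walk P x y → y ≢ t → Walk (_≢ t) x y ⊎ ∃ λ c → adj T t c ≡ true × Walk (_≢ t) c y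
  last-exit t [ _ ] y≢t = inj₁ [ y≢t ]
  last-exit t (_∷⟨_⟩_ {x} {u} _ e w) y≢t with last-exit t w y≢t
  ... | inj₂ exit = inj₂ exit
  ... | inj₁ w′ with x ≟ t
  ...   | yes refl = inj₂ (u , e , w′)
  ...   | no x≢t = inj₁ (x≢t ∷⟨ e ⟩ w′)

  entry : ∀ t x → x ≢ t → ∃ λ c → adj T t c ≡ true × Walk (_≢ t) c x
  entry t x x≢t with last-exit t (fromReach (connected t x ∈⊤ ∈⊤)) x≢t
  ... | inj₁ w = ⊥-elim (source w refl)
  ... | inj₂ exit = exit

  -- The neighbour of t through which x is reached; branch t t = t is a junk value.
  branch : Vertex T → Vertex T → Vertex T
  branch t x with x ≟ t
  ... | yes _ = t
  ... | no x≢t = proj₁ (entry t x x≢t)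

  branch-spec : x ≢ t → adj T t (branch t x) ≡ true × Walk (_≢ t) (branch t x) x
  branch-spec {x} {t} x≢t with x ≟ t
  ... | yes x≡t = ⊥-elim (x≢t x≡t)
  ... | no x≢t′ = proj₂ (entry t x x≢t′)

  branch-walk : x ≢ t → y ≢ t → Walk (_≢ t) x y → branch t x ≡ branch t y
  branch-walk {x} {t} {y} x≢t y≢t w with branch-spec x≢t | branch-spec y≢t
  ... | t-cx , wx | t-cy , wy = acyclic-unique-neighbour acyclic t-cx t-cy (wx ++ w ++ reverse wy)

  branch-neighbour : adj T t c ≡ true → branch t c ≡ c
  branch-neighbour t-c with branch-spec (λ c≡t → adj⇒≢ t-c (sym c≡t))
  ... | t-b , w = acyclic-unique-neighbour acyclic t-b t-c w

  branch-adj : x ≢ t → y ≢ t → adj T x y ≡ true → branch t x ≡ branch t y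
  branch-adj x≢t y≢t x-y = branch-walk x≢t y≢t (x≢t ∷⟨ x-y ⟩ [ y≢t ])

  branch-opposite : adj T t c ≡ true → x ≢ t → branch t x ≡ c → x ≢ c → branch c x ≢ t
  branch-opposite {t} {c} {x} t-c x≢t bx≡c x≢c bcx≡t with branch-spec x≢c
  ... | _ , w with last-step (reverse (subst (λ v → Walk (_≢ c) v x) bcx≡t w)) x≢t
  ...   | d , d-t , w′ = proj₁ (target w′) d≡c
    where
    d≡c : d ≡ c
    d≡c = trans (sym (branch-neighbour (adj-sym d-t)))
            (trans (sym (branch-walk x≢t (proj₂ (target w′)) (map proj₂ w′))) bx≡c)

  branch-nested : ∀ {c′} → adj T t c ≡ true → adj T c c′ ≡ true → c′ ≢ t → x ≢ c → branch c x ≡ c′ →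
                  x ≢ t × branch t x ≡ c
  branch-nested {t} {c} {x} {c′} t-c c-c′ c′≢t x≢c bcx≡c′ = x≢t , btx≡c
    where
    c≢t : c ≢ t
    c≢t c≡t = adj⇒≢ t-c (sym c≡t)
    x≢t : x ≢ t
    x≢t refl = c′≢t (trans (sym bcx≡c′) (branch-neighbour (adj-sym t-c)))
    btx≡c : branch t x ≡ c
    btx≡c with cut-at t (subst (λ v → Walk (_≢ c) v x) bcx≡c′ (proj₂ (branch-spec x≢c)))
    ... | inj₁ w = ⊥-elim (c′≢t (trans (sym (branch-neighbour c-c′))
                      (trans (branch-walk (λ c′≡c → adj⇒≢ c-c′ (sym c′≡c)) (λ t≡c → c≢t (sym t≡c)) w)
                             (branch-neighbour (adj-sym t-c)))))
    ... | inj₂ w = trans (branch-walk x≢t c≢t (reverse (map proj₂ w) ++ (c′≢t ∷⟨ adj-sym c-c′ ⟩ [ c≢t ])))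
                         (branch-neighbour t-c)

  walk-between-branches : ∀ {X : Subset (size T)} → Walk (_∈ X) x y → x ≢ t → y ≢ t → branch t x ≢ branch t y → t ∈ X
  walk-between-branches {t = t} w x≢t y≢t bx≢by with cut-at t w
  ... | inj₁ w′ = target w′
  ... | inj₂ w′ = ⊥-elim (bx≢by (branch-walk x≢t y≢t (map proj₂ w′)))

  walk-leaving-branch : ∀ {X : Subset (size T)} → Walk (_∈ X) x y → x ≢ t → branch t x ≡ c →
                        (y ≡ t ⊎ (y ≢ t × branch t y ≢ c)) → c ∈ X
  walk-leaving-branch [ _ ] x≢t _ (inj₁ refl) = ⊥-elim (x≢t refl)
  walk-leaving-branch [ _ ] _ bx≡c (inj₂ (_ , by≢c)) = ⊥-elim (by≢c bx≡c)
  walk-leaving-branch {t = t} {X = X} (_∷⟨_⟩_ {y = u} x∈X e w) x≢t bx≡c leaves with u ≟ t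
  ... | yes refl = subst (_∈ X) (trans (sym (branch-neighbour (adj-sym e))) bx≡c) x∈X
  ... | no u≢t = walk-leaving-branch w u≢t (trans (sym (branch-adj x≢t u≢t e)) bx≡c) leaves

  nodes-in-branch : Vertex T → Vertex T → Subset (size T)
  nodes-in-branch t c = ⟦ (λ x → ¬? (x ≟ t) ×-dec branch t x ≟ c) ⟧

  nodes-in-branch-shrink : ∀ {c′} → adj T t c ≡ true → adj T c c′ ≡ true → c′ ≢ t →
                           ∣ nodes-in-branch c c′ ∣ < ∣ nodes-in-branch t c ∣
  nodes-in-branch-shrink {t} {c} t-c c-c′ c′≢t = p⊂q⇒∣p∣<∣q∣ (nested , c , c∈ , c∉)
    where
    nested : nodes-in-branch c _ ⊆ nodes-in-branch t c
    nested x∈ = ∈⟦⟧⁺ _ (branch-nested t-c c-c′ c′≢t (proj₁ (∈⟦⟧⁻ _ x∈)) (proj₂ (∈⟦⟧⁻ _ x∈)))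
    c∈ = ∈⟦⟧⁺ _ ((λ c≡t → adj⇒≢ t-c (sym c≡t)) , branch-neighbour t-c)
    c∉ = λ c∈′ → proj₁ (∈⟦⟧⁻ _ c∈′) refl

module Separations (G : Graph) where

  open Walks G using (adj⇒≢)

  private
    variable
      v w : Vertex G

  edge : ∀ v w → adj G v w ≡ true → Edge G
  edge v w v-w with <-cmp v w
  ... | tri< v<w _ _ = (v , w) , v<w , v-w
  ... | tri≈ _ v≡w _ = ⊥-elim (adj⇒≢ v-w v≡w)
  ... | tri> _ _ w<v = (w , v) , w<v , trans (symm G w v) v-w

  edge-incident : ∀ v w v-w → Incident G v (edge v w v-w)
  edge-incident v w v-w with <-cmp v w
  ... | tri< _ _ _ = inj₁ refl
  ... | tri≈ _ v≡w _ = ⊥-elim (adj⇒≢ v-w v≡w)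
  ... | tri> _ _ _ = inj₂ refl

  Edge-≡ : (e e′ : Edge G) → proj₁ e ≡ proj₁ e′ → e ≡ e′
  Edge-≡ (_ , u<v , u-v) (_ , u<v′ , u-v′) refl
    rewrite <-irrelevant u<v u<v′ | Decidable⇒UIP.≡-irrelevant Bool._≟_ u-v u-v′ = refl

  incident⇒edge : ∀ v (e : Edge G) → Incident G v e → ∃ λ w → Σ (adj G v w ≡ true) λ v-w → edge v w v-w ≡ e
  incident⇒edge v ((v , w) , v<w , v-w) (inj₁ refl) = w , v-w , same
    where
    same : edge v w v-w ≡ ((v , w) , v<w , v-w)
    same with <-cmp v w
    ... | tri< _ _ _ = Edge-≡ _ _ refl
    ... | tri≈ _ v≡w _ = ⊥-elim (adj⇒≢ v-w v≡w)
    ... | tri> v≮w _ _ = ⊥-elim (v≮w v<w)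
  incident⇒edge v ((u , v) , u<v , u-v) (inj₂ refl) = u , v-u , same
    where
    v-u = trans (symm G v u) u-v
    same : edge v u v-u ≡ ((u , v) , u<v , u-v)
    same with <-cmp v u
    ... | tri< _ _ v≯u = ⊥-elim (v≯u u<v)
    ... | tri≈ _ v≡u _ = ⊥-elim (adj⇒≢ v-u v≡u)
    ... | tri> _ _ _ = Edge-≡ _ _ refl

  -- Quantifying over neighbours rather than over edges makes this decidable.
  Touches : (Edge G → Set) → Vertex G → Set
  Touches E v = ∃ λ w → Σ (adj G v w ≡ true) λ v-w → E (edge v w v-w)

  touches⁺ : ∀ {E} e → Incident G v e → E e → Touches E v
  touches⁺ {v} {E} e v∈e Ee with incident⇒edge v e v∈e
  ... | w , v-w , refl = w , v-w , Ee

  touches⁻ : ∀ {E} → Touches E v → ∃ λ e → Incident G v e × E e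
  touches⁻ {v} (w , v-w , Ee) = edge v w v-w , edge-incident v w v-w , Ee

  touches? : ∀ {E} → (∀ e → Dec (E e)) → ∀ v → Dec (Touches E v)
  touches? E? v = any? λ w → adjacent-and? (adj G v w) (λ v-w → E? (edge v w v-w))
    where
    adjacent-and? : ∀ b {Q : b ≡ true → Set} → (∀ p → Dec (Q p)) → Dec (Σ (b ≡ true) Q)
    adjacent-and? true Q? with Q? refl
    ... | yes q = yes (refl , q)
    ... | no ¬q = no λ { (refl , q) → ¬q q }
    adjacent-and? false _ = no λ { (() , _) }

  -- G₁ consists of the edges in E and their ends, G₂ of the remaining edges and all other vertices.
  module EdgeSeparation {E : Edge G → Set} (E? : ∀ e → Dec (E e)) where

    side₁? : ∀ v → Dec (Touches E v)
    side₁? = touches? E?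

    side₂? : ∀ v → Dec (¬ Touches E v ⊎ Touches (¬_ ∘ E) v)
    side₂? v = ¬? (touches? E? v) ⊎-dec touches? (λ e → ¬? (E? e)) v

    side₁ side₂ : Subset (size G)
    side₁ = ⟦ side₁? ⟧
    side₂ = ⟦ side₂? ⟧

    separation : Separation G
    separation = record
      { G₁ = record { verts = side₁ ; edges = E ; closed = λ e Ee →
                        ∈⟦⟧⁺ side₁? (touches⁺ {E = E} e (inj₁ refl) Ee) , ∈⟦⟧⁺ side₁? (touches⁺ {E = E} e (inj₂ refl) Ee) }
      ; G₂ = record { verts = side₂ ; edges = λ e → ¬ E e ; closed = λ e ¬Ee →
                        ∈⟦⟧⁺ side₂? (inj₂ (touches⁺ {E = ¬_ ∘ E} e (inj₁ refl) ¬Ee)) , ∈⟦⟧⁺ side₂? (inj₂ (touches⁺ {E = ¬_ ∘ E} e (inj₂ refl) ¬Ee)) }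
      ; coverV = cover-vertex
      ; coverE = cover-edge
      }
      where
      cover-vertex : ∀ v → v ∈ side₁ ⊎ v ∈ side₂
      cover-vertex v with side₁? v
      ... | yes v∈₁ = inj₁ (∈⟦⟧⁺ side₁? v∈₁)
      ... | no v∉₁ = inj₂ (∈⟦⟧⁺ side₂? (inj₁ v∉₁))
      cover-edge : ∀ e → E e ⊎ ¬ E e
      cover-edge e with E? e
      ... | yes Ee = inj₁ Ee
      ... | no ¬Ee = inj₂ ¬Ee

    separator⇒touches-both : v ∈ side₁ ∩ side₂ → Touches E v × Touches (λ e → ¬ E e) v
    separator⇒touches-both v∈ with x∈p∩q⁻ side₁ side₂ v∈
    ... | v∈₁ , v∈₂ with ∈⟦⟧⁻ side₂? v∈₂
    ... | inj₁ v∉₁ = ⊥-elim (v∉₁ (∈⟦⟧⁻ side₁? v∈₁))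
    ... | inj₂ touches¬E = ∈⟦⟧⁻ side₁? v∈₁ , touches¬E

  isolated-separation : ∀ u → (∀ w → adj G u w ≢ true) →
    Σ (Separation G) λ s → order s ≡ 0 × verts (G₁ s) ≡ ⁅ u ⁆ × (∀ v → v ≢ u → v ∈ verts (G₂ s))
  isolated-separation u isolated = s , order≡0 , refl , λ v → ∈⟦⟧⁺ others?
    where
    others? = λ v → ¬? (v ≟ u)
    others = ⟦ others? ⟧
    cover-vertex : ∀ v → v ∈ ⁅ u ⁆ ⊎ v ∈ others
    cover-vertex v with v ≟ u
    ... | yes refl = inj₁ (x∈⁅x⁆ u)
    ... | no v≢u = inj₂ (∈⟦⟧⁺ others? v≢u)
    s : Separation G
    s = record
      { G₁ = record { verts = ⁅ u ⁆ ; edges = λ _ → Data.Empty.⊥ ; closed = λ _ () }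
      ; G₂ = record { verts = others ; edges = λ _ → ⊤ ; closed = λ { ((a , b) , _ , a-b) _ →
              ∈⟦⟧⁺ others? (λ { refl → isolated b a-b }) , ∈⟦⟧⁺ others? (λ { refl → isolated a (trans (symm G u a) a-b) }) } }
      ; coverV = cover-vertex
      ; coverE = λ _ → inj₂ tt
      }
    order≡0 : order s ≡ 0
    order≡0 = Empty⇒∣p∣≡0 λ (v , v∈) → let v∈u , v∈others = x∈p∩q⁻ ⁅ u ⁆ others v∈ in
                                       ∈⟦⟧⁻ others? v∈others (x∈⁅y⁆⇒x≡y u v∈u)

module LargeThetaConnected {G : Graph} (U : Subset (size G)) (K : ℕ) (K>0 : 0 < K)
                           (U-connected : ThetaConnected (suc K) G U) (U-large : 3 * K < ∣ U ∣) where

  U₁ U₂ : Separation G → Subset (size G)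
  U₁ s = U ∩ verts (G₁ s)
  U₂ s = U ∩ verts (G₂ s)

  ∣U∣≤∣U₁∣+∣U₂∣ : ∀ s → ∣ U ∣ ≤ ∣ U₁ s ∣ + ∣ U₂ s ∣
  ∣U∣≤∣U₁∣+∣U₂∣ s = covered⇒∣r∣≤∣p∣+∣q∣ {p = U₁ s} {U₂ s} {U} λ {v} v∈U → Data.Sum.map (λ v∈₁ → x∈p∩q⁺ (v∈U , v∈₁)) (λ v∈₂ → x∈p∩q⁺ (v∈U , v∈₂)) (coverV s v)

  other-side-small : ∀ s → order s < suc K → order s < ∣ U₁ s ∣ → ∣ U₂ s ∣ ≤ order s
  other-side-small s o<θ o<∣U₁∣ with ∣ U₂ s ∣ ≤? order s
  ... | yes ok = ok
  ... | no ∣U₂∣≰o = ⊥-elim (<⇒≱ (⊓-pres-m< o<∣U₁∣ (≰⇒> ∣U₂∣≰o)) (U-connected s o<θ))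

  -- 3K < |U| leaves no room for both sides to contain more than K vertices of U.
  side-small⇒≤order : ∀ s → order s ≤ K → ∣ U₁ s ∣ ≤ K + K → ∣ U₁ s ∣ ≤ order s
  side-small⇒≤order s o≤K ∣U₁∣≤2K with ∣ U₁ s ∣ ≤? order s
  ... | yes ok = ok
  ... | no ∣U₁∣≰o = ⊥-elim (<⇒≱ U-large (begin
    ∣ U ∣                  ≤⟨ ∣U∣≤∣U₁∣+∣U₂∣ s ⟩
    ∣ U₁ s ∣ + ∣ U₂ s ∣     ≤⟨ +-mono-≤ ∣U₁∣≤2K (≤-trans (other-side-small s (s≤s o≤K) (≰⇒> ∣U₁∣≰o)) o≤K) ⟩
    K + K + K              ≡⟨ +-assoc K K K ⟩
    K + (K + K)            ≡⟨ cong (λ k → K + (K + k)) (+-identityʳ K) ⟨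
    3 * K                  ∎))
    where open ≤-Reasoning

  small-side : ∀ s → order s ≤ K → ∣ U₁ s ∣ ≤ K → ∣ U₁ s ∣ ≤ order s
  small-side s o≤K ∣U₁∣≤K = side-small⇒≤order s o≤K (≤-trans ∣U₁∣≤K (m≤m+n K K))

  small-union : ∀ s {A B} → order s ≤ K → (∀ {v} → v ∈ U₁ s → v ∈ A ⊎ v ∈ B) → ∣ A ∣ ≤ K → ∣ B ∣ ≤ K → ∣ U₁ s ∣ ≤ K
  small-union s o≤K cover ∣A∣≤K ∣B∣≤K =
    ≤-trans (side-small⇒≤order s o≤K (≤-trans (covered⇒∣r∣≤∣p∣+∣q∣ cover) (+-mono-≤ ∣A∣≤K ∣B∣≤K))) o≤K

  has-neighbour : ∀ {u} → u ∈ U → ∃ λ w → adj G u w ≡ true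
  has-neighbour {u} u∈U with any? (λ w → adj G u w Bool.≟ true)
  ... | yes neighbour = neighbour
  ... | no isolated with Separations.isolated-separation G u (λ w u-w → isolated (w , u-w))
  ... | s , order≡0 , refl , _ = ⊥-elim (<⇒≱ U-large (begin
    ∣ U ∣                  ≤⟨ ∣U∣≤∣U₁∣+∣U₂∣ s ⟩
    ∣ U₁ s ∣ + ∣ U₂ s ∣     ≤⟨ +-mono-≤ ∣U₁∣≤1 ∣U₂∣≤0 ⟩
    1                      ≤⟨ s≤s z≤n ⟩
    3 * 1                  ≤⟨ *-monoʳ-≤ 3 K>0 ⟩
    3 * K                  ∎))
    where
    open ≤-Reasoning
    ∣U₁∣≤1 : ∣ U₁ s ∣ ≤ 1
    ∣U₁∣≤1 = ≤-trans (∣p∩q∣≤∣q∣ U ⁅ u ⁆) (≤-reflexive (∣⁅x⁆∣≡1 u))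
    ∣U₂∣≤0 : ∣ U₂ s ∣ ≤ 0
    ∣U₂∣≤0 = subst (∣ U₂ s ∣ ≤_) order≡0
               (other-side-small s (subst (_< suc K) (sym order≡0) (s≤s z≤n))
                 (subst (_< ∣ U₁ s ∣) (sym order≡0) (x∈p⇒∣p∣>0 (x∈p∩q⁺ (u∈U , x∈⁅x⁆ u)))))

module BranchSeparations {G : Graph} (D : TreeDecomposition G) where

  open Branches (tree D) (isTree D) public
  open Separations G public

  private
    variable
      t c : Vertex (tree D)
      v : Vertex G
      e e₁ e₂ : Edge G

  leaf : Edge G → Vertex (tree D)
  leaf = leafOf D

  bag-at-leaf : Incident G v e → leaf e ≡ t → Bag D t v
  bag-at-leaf {e = e} v∈e refl _ _ X∋leaves = X∋leaves e v∈e

  bag-between-branches : Incident G v e₁ → Incident G v e₂ → leaf e₁ ≢ t → leaf e₂ ≢ t →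
                         branch t (leaf e₁) ≢ branch t (leaf e₂) → Bag D t v
  bag-between-branches {e₁ = e₁} {e₂} v∈e₁ v∈e₂ ℓ₁≢t ℓ₂≢t apart _ X-connected X∋leaves =
    walk-between-branches (fromReach (X-connected _ _ (X∋leaves e₁ v∈e₁) (X∋leaves e₂ v∈e₂))) ℓ₁≢t ℓ₂≢t apart

  bag-at-entry : Incident G v e₁ → Incident G v e₂ → leaf e₁ ≢ t → branch t (leaf e₁) ≡ c →
                 (leaf e₂ ≡ t ⊎ (leaf e₂ ≢ t × branch t (leaf e₂) ≢ c)) → Bag D c v
  bag-at-entry {e₁ = e₁} {e₂} v∈e₁ v∈e₂ ℓ₁≢t in-c leaves-c _ X-connected X∋leaves =
    walk-leaving-branch (fromReach (X-connected _ _ (X∋leaves e₁ v∈e₁) (X∋leaves e₂ v∈e₂))) ℓ₁≢t in-c leaves-c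

  InBranch : Vertex (tree D) → Vertex (tree D) → Edge G → Set
  InBranch t c e = leaf e ≢ t × branch t (leaf e) ≡ c

  in-branch? : ∀ t c e → Dec (InBranch t c e)
  in-branch? t c e = ¬? (leaf e ≟ t) ×-dec (branch t (leaf e) ≟ c)

  module BranchSeparation (t c : Vertex (tree D)) = EdgeSeparation (in-branch? t c)
  open BranchSeparation public using (separation; side₁; side₂; separator⇒touches-both)

  separator : Vertex (tree D) → Vertex (tree D) → Subset (size G)
  separator t c = side₁ t c ∩ side₂ t c

  separator⊆bags : v ∈ separator t c → Bag D t v × Bag D c v
  separator⊆bags {v} {t} {c} v∈ with separator⇒touches-both t c v∈
  ... | touches-c , touches-rest with touches⁻ {E = InBranch t c} touches-c | touches⁻ {E = ¬_ ∘ InBranch t c} touches-rest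
  ... | e₁ , v∈e₁ , (ℓ₁≢t , in-c) | e₂ , v∈e₂ , ¬in-c = bags (leaf e₂ ≟ t)
    where
    bags : Dec (leaf e₂ ≡ t) → Bag D t v × Bag D c v
    bags (yes ℓ₂≡t) = bag-at-leaf v∈e₂ ℓ₂≡t , bag-at-entry v∈e₁ v∈e₂ ℓ₁≢t in-c (inj₁ ℓ₂≡t)
    bags (no ℓ₂≢t) = bag-between-branches v∈e₁ v∈e₂ ℓ₁≢t ℓ₂≢t (λ same → ¬in-c (ℓ₂≢t , trans (sym same) in-c)) ,
                     bag-at-entry v∈e₁ v∈e₂ ℓ₁≢t in-c (inj₂ (ℓ₂≢t , λ in-c₂ → ¬in-c (ℓ₂≢t , in-c₂)))

  module _ {K : ℕ} (adhesion : AdhesionBelow D (suc K)) where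

    adhesion-bound : ∀ {A : Subset (size G)} → adj (tree D) t c ≡ true →
                     (∀ {v} → v ∈ A → Bag D t v × Bag D c v) → ∣ A ∣ ≤ K
    adhesion-bound {t} {c} {A} t-c A⊆bags with enumerate A
    ... | f , f-injective , f∈A = ≤-pred (adhesion t c t-c ∣ A ∣ f f-injective (λ i → A⊆bags (f∈A i)))

    separator-bound : adj (tree D) t c ≡ true → ∣ separator t c ∣ ≤ K
    separator-bound t-c = adhesion-bound t-c separator⊆bags

  side-opposite : adj (tree D) t c ≡ true → side₁ c t ⊆ side₂ t c
  side-opposite {t} {c} t-c v∈ with ∈⟦⟧⁻ (BranchSeparation.side₁? c t) v∈
  ... | w , v-w , (ℓ≢c , in-t) =
    ∈⟦⟧⁺ (BranchSeparation.side₂? t c) (inj₂ (w , v-w , λ (ℓ≢t , in-c) → branch-opposite t-c ℓ≢t in-c ℓ≢c in-t))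

module Sinks {G : Graph} (U : Subset (size G)) (K : ℕ) (K>0 : 0 < K)
             (U-connected : ThetaConnected (suc K) G U) (U-large : 3 * K < ∣ U ∣)
             (D : TreeDecomposition G) (adhesion : AdhesionBelow D (suc K)) where

  open LargeThetaConnected U K K>0 U-connected U-large
  open BranchSeparations D

  Light : Vertex (tree D) → Vertex (tree D) → Set
  Light t c = ∣ U ∩ side₁ t c ∣ ≤ K

  Sink : Vertex (tree D) → Set
  Sink t = ∀ c → adj (tree D) t c ≡ true → Light t c

  heavy⇒reverse-light : ∀ {t c} → adj (tree D) t c ≡ true → ¬ Light t c → Light c t
  heavy⇒reverse-light {t} {c} t-c heavy = begin
    ∣ U ∩ side₁ c t ∣            ≤⟨ p⊆q⇒∣p∣≤∣q∣ (λ v∈ → let v∈U , v∈₁ = x∈p∩q⁻ U _ v∈ in x∈p∩q⁺ (v∈U , side-opposite t-c v∈₁)) ⟩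
    ∣ U₂ (separation t c) ∣      ≤⟨ other-side-small (separation t c) (s≤s order≤K) (≤-<-trans order≤K (≰⇒> heavy)) ⟩
    order (separation t c)      ≤⟨ order≤K ⟩
    K                           ∎
    where
    open ≤-Reasoning
    order≤K = separator-bound adhesion t-c

  sink? : ∀ t → Dec (Sink t)
  sink? t = all? λ c → (adj (tree D) t c Bool.≟ true) →-dec (∣ U ∩ side₁ t c ∣ ≤? K)

  heavy-branch : ∀ {t} → ¬ Sink t → ∃ λ c → adj (tree D) t c ≡ true × ¬ Light t c
  heavy-branch {t} not-sink with ¬∀⟶∃¬ _ _ (λ c → (adj (tree D) t c Bool.≟ true) →-dec (∣ U ∩ side₁ t c ∣ ≤? K)) not-sink
  ... | c , ¬light-if-adjacent with adj (tree D) t c Bool.≟ true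
  ...   | yes t-c = c , t-c , λ light → ¬light-if-adjacent (λ _ → light)
  ...   | no ¬t-c = ⊥-elim (¬light-if-adjacent (λ t-c → ⊥-elim (¬t-c t-c)))

  -- Walking into a heavy branch never turns back, and the branch ahead strictly shrinks.
  descend : ∀ {t c} fuel → adj (tree D) t c ≡ true → ¬ Light t c → ∣ nodes-in-branch t c ∣ < fuel → Σ _ Sink
  descend {t} {c} (suc fuel) t-c heavy ∣branch∣<fuel with sink? c
  ... | yes c-sink = c , c-sink
  ... | no c-not-sink with heavy-branch c-not-sink
  ... | c′ , c-c′ , heavy′ = descend fuel c-c′ heavy′ (≤-trans (nodes-in-branch-shrink t-c c-c′ c′≢t) (≤-pred ∣branch∣<fuel))
    where
    c′≢t : c′ ≢ t
    c′≢t refl = heavy′ (heavy⇒reverse-light t-c heavy)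

  sink : Σ _ Sink
  sink with sink? root
    where root = fromℕ< (proj₁ (isTree D))
  ... | yes root-sink = _ , root-sink
  ... | no root-not-sink with heavy-branch root-not-sink
  ... | c , root-c , heavy = descend (suc (size (tree D))) root-c heavy (s≤s (∣p∣≤n (nodes-in-branch _ c)))

  module AtSink (t : Vertex (tree D)) (t-sink : Sink t) where

    private
      variable
        u v : Vertex G

    light-everywhere : ∀ c → Light t c
    light-everywhere c with adj (tree D) t c Bool.≟ true
    ... | yes t-c = t-sink c t-c
    ... | no ¬t-c = subst (_≤ K) (sym (Empty⇒∣p∣≡0 λ (v , v∈) → no-edge (proj₂ (x∈p∩q⁻ U _ v∈)))) z≤n
      where
      no-edge : v ∉ side₁ t c
      no-edge v∈ with ∈⟦⟧⁻ (BranchSeparation.side₁? t c) v∈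
      ... | _ , _ , (ℓ≢t , in-c) = ¬t-c (subst (λ b → adj (tree D) t b ≡ true) in-c (proj₁ (branch-spec ℓ≢t)))

    AtNode : Edge G → Set
    AtNode e = leaf e ≡ t

    Apart : Vertex G → Edge G → Set
    Apart v e₁ = leaf e₁ ≢ t × Touches (λ e₂ → leaf e₂ ≢ t × branch t (leaf e₁) ≢ branch t (leaf e₂)) v

    -- A decidable part of the bag Y_t that still contains every separator at t.
    core : Subset (size G)
    core = ⟦ core? ⟧
      where
      apart? : ∀ v e₁ → Dec (Apart v e₁)
      apart? v e₁ = ¬? (leaf e₁ ≟ t) ×-dec touches? (λ e₂ → ¬? (leaf e₂ ≟ t) ×-dec ¬? (branch t (leaf e₁) ≟ branch t (leaf e₂))) v
      core? = λ v → touches? (λ e → leaf e ≟ t) v ⊎-dec touches? (apart? v) v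

    core⊆bag : v ∈ core → Bag D t v
    core⊆bag v∈ with ∈⟦⟧⁻ _ v∈
    ... | inj₁ at-node with touches⁻ {E = AtNode} at-node
    ...   | e , v∈e , ℓ≡t = bag-at-leaf v∈e ℓ≡t
    core⊆bag {v} v∈ | inj₂ (w , v-w , (ℓ₁≢t , apart)) with touches⁻ {E = λ e₂ → leaf e₂ ≢ t × branch t (leaf (edge v w v-w)) ≢ branch t (leaf e₂)} apart
    ...   | e₂ , v∈e₂ , (ℓ₂≢t , b₁≢b₂) = bag-between-branches (edge-incident v w v-w) v∈e₂ ℓ₁≢t ℓ₂≢t b₁≢b₂

    separator⊆core : ∀ {c} → separator t c ⊆ core
    separator⊆core {c} {v} v∈ with separator⇒touches-both t c v∈
    ... | touches-c , touches-rest with touches⁻ {E = InBranch t c} touches-c | touches⁻ {E = ¬_ ∘ InBranch t c} touches-rest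
    ... | e₁ , v∈e₁ , (ℓ₁≢t , in-c) | e₂ , v∈e₂ , ¬in-c = in-core (leaf e₂ ≟ t)
      where
      in-core : Dec (leaf e₂ ≡ t) → v ∈ core
      in-core (yes ℓ₂≡t) = ∈⟦⟧⁺ _ (inj₁ (touches⁺ {E = AtNode} e₂ v∈e₂ ℓ₂≡t))
      in-core (no ℓ₂≢t) = ∈⟦⟧⁺ _ (inj₂ (touches⁺ {E = Apart v} e₁ v∈e₁ (ℓ₁≢t ,
                            touches⁺ e₂ v∈e₂ (ℓ₂≢t , λ same → ¬in-c (ℓ₂≢t , trans (sym same) in-c)))))

    outer : Subset (size G)
    outer = ⟦ (λ u → u ∈? U ×-dec ¬? (u ∈? core)) ⟧

    -- For isolated u the attachment is the junk value ⊥; vertices of U are never isolated.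
    attachment : ∀ u → Dec (∃ λ w → adj G u w ≡ true) → Subset (size G)
    attachment u (yes (w , u-w)) = separator t (branch t (leaf (edge u w u-w)))
    attachment u (no _) = ⊥

    attach : Vertex G → Subset (size G)
    attach u = attachment u (any? λ w → adj G u w Bool.≟ true)

    outer-edge-off-node : ∀ {w} (u-w : adj G u w ≡ true) → u ∈ outer → leaf (edge u w u-w) ≢ t
    outer-edge-off-node {u} {w} u-w u∈ ℓ≡t = proj₂ (∈⟦⟧⁻ _ u∈) (∈⟦⟧⁺ _ (inj₁ (touches⁺ {E = AtNode} _ (edge-incident u w u-w) ℓ≡t)))

    attach-bounded : Bounded (∁ U) K core outer attach
    attach-bounded {u} u∈ = bounded (any? λ w → adj G u w Bool.≟ true)
      where
      bounded : ∀ d → attachment u d ⊆ core × ∣ attachment u d ∣ ≤ K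
      bounded (yes (w , u-w)) = separator⊆core , separator-bound adhesion (proj₁ (branch-spec (outer-edge-off-node u-w u∈)))
      bounded (no isolated) = ⊥-elim (isolated (has-neighbour (proj₁ (∈⟦⟧⁻ _ u∈))))

    -- The branches at t whose separators lie in X form a single separation of order at most |X| ≤ K whose
    -- branch side is light; it contains every u with attach u ⊆ X but, as X ⊆ core, none of them in its separator.
    module Sparsity (X : Subset (size G)) (X⊆core : X ⊆ core) (∣X∣≤K : ∣ X ∣ ≤ K) where

      -- Branches are added in the order of their index, so that the union can be built up one branch at a time.
      Enclosed : ℕ → Edge G → Set
      Enclosed i e = leaf e ≢ t × separator t (branch t (leaf e)) ⊆ X × toℕ (branch t (leaf e)) < i

      enclosed? : ∀ i e → Dec (Enclosed i e)
      enclosed? i e = ¬? (leaf e ≟ t) ×-dec separator t (branch t (leaf e)) ⊆? X ×-dec toℕ (branch t (leaf e)) <? i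

      module Union (i : ℕ) = EdgeSeparation (enclosed? i)

      union-separator⊆X : ∀ i → Union.side₁ i ∩ Union.side₂ i ⊆ X
      union-separator⊆X i {v} v∈ with Union.separator⇒touches-both i v∈
      ... | (w , v-w , (ℓ≢t , sep⊆X , b<i)) , (w₂ , v-w₂ , ¬enclosed₂) = sep⊆X (x∈p∩q⁺ (v∈side₁ , v∈side₂))
        where
        b = branch t (leaf (edge v w v-w))
        v∈side₁ : v ∈ side₁ t b
        v∈side₁ = ∈⟦⟧⁺ (BranchSeparation.side₁? t b) (w , v-w , (ℓ≢t , refl))
        v∈side₂ : v ∈ side₂ t b
        v∈side₂ = ∈⟦⟧⁺ (BranchSeparation.side₂? t b) (inj₂ (w₂ , v-w₂ , λ (ℓ₂≢t , in-c) →
                    ¬enclosed₂ (ℓ₂≢t , subst (λ b → separator t b ⊆ X) (sym in-c) sep⊆X , subst (λ b → toℕ b < i) (sym in-c) b<i)))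

      union-order : ∀ i → order (Union.separation i) ≤ K
      union-order i = ≤-trans (p⊆q⇒∣p∣≤∣q∣ (union-separator⊆X i)) ∣X∣≤K

      union-light : ∀ i → i ≤ size (tree D) → ∣ U ∩ Union.side₁ i ∣ ≤ K
      union-light zero _ = subst (_≤ K) (sym (Empty⇒∣p∣≡0 nothing-enclosed)) z≤n
        where
        nothing-enclosed : Empty (U ∩ Union.side₁ 0)
        nothing-enclosed (v , v∈) with ∈⟦⟧⁻ (Union.side₁? 0) (proj₂ (x∈p∩q⁻ U _ v∈))
        ... | _ , _ , (_ , _ , ())
      union-light (suc i) i<N =
        small-union (Union.separation (suc i)) (union-order (suc i)) cover (union-light i (≤-trans (n≤1+n i) i<N)) (light-everywhere c)
        where
        c = fromℕ< i<N
        cover : v ∈ U ∩ Union.side₁ (suc i) → v ∈ U ∩ Union.side₁ i ⊎ v ∈ U ∩ side₁ t c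
        cover v∈ with x∈p∩q⁻ U _ v∈
        ... | v∈U , v∈side with ∈⟦⟧⁻ (Union.side₁? (suc i)) v∈side
        ... | w , v-w , (ℓ≢t , sep⊆X , s≤s b≤i) with m≤n⇒m<n∨m≡n b≤i
        ...   | inj₁ b<i = inj₁ (x∈p∩q⁺ (v∈U , ∈⟦⟧⁺ (Union.side₁? i) (w , v-w , (ℓ≢t , sep⊆X , b<i))))
        ...   | inj₂ b≡i = inj₂ (x∈p∩q⁺ (v∈U , ∈⟦⟧⁺ (BranchSeparation.side₁? t c)
                             (w , v-w , (ℓ≢t , toℕ-injective (trans b≡i (sym (toℕ-fromℕ< i<N)))))))

      N : ℕ
      N = size (tree D)

      side O : Subset (size G)
      side = Union.side₁ N
      O = Union.side₁ N ∩ Union.side₂ N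

      selected⊆side : selected (∁ U) outer attach X ⊆ side
      selected⊆side {u} u∈ with ∈⟦⟧⁻ _ u∈
      ... | u∈outer , attach⊆X = enclosed (any? λ w → adj G u w Bool.≟ true) (λ {v} → attach⊆X {v})
        where
        enclosed : ∀ d → attachment u d ⊆ X → u ∈ side
        enclosed (yes (w , u-w)) ⊆X = ∈⟦⟧⁺ (Union.side₁? N) (w , u-w , (outer-edge-off-node u-w u∈outer , ⊆X , toℕ<n _))
        enclosed (no isolated) _ = ⊥-elim (isolated (has-neighbour (proj₁ (∈⟦⟧⁻ _ u∈outer))))

      sparse : ∣ selected (∁ U) outer attach X ∣ ≤ ∣ X ∩ ∁ U ∣ + 0
      sparse = ≤-trans (+-cancelʳ-≤ ∣ U ∩ O ∣ _ _ (begin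
        ∣ selected (∁ U) outer attach X ∣ + ∣ U ∩ O ∣  ≤⟨ disjoint⇒∣p∣+∣q∣≤∣r∣ sel#O sel⊆ U∩O⊆ ⟩
        ∣ U ∩ side ∣                                  ≤⟨ small-side (Union.separation N) (union-order N) (union-light N ≤-refl) ⟩
        ∣ O ∣                                         ≤⟨ covered⇒∣r∣≤∣p∣+∣q∣ in-U-or-not ⟩
        ∣ O ∩ ∁ U ∣ + ∣ U ∩ O ∣                         ∎))
        (≤-trans (p⊆q⇒∣p∣≤∣q∣ O∖U⊆X∖U) (m≤m+n _ 0))
        where
        open ≤-Reasoning
        sel⊆ : selected (∁ U) outer attach X ⊆ U ∩ side
        sel⊆ u∈ = x∈p∩q⁺ (proj₁ (∈⟦⟧⁻ _ (proj₁ (∈⟦⟧⁻ _ u∈))) , selected⊆side u∈)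
        U∩O⊆ : U ∩ O ⊆ U ∩ side
        U∩O⊆ v∈ with x∈p∩q⁻ U O v∈
        ... | v∈U , v∈O = x∈p∩q⁺ (v∈U , proj₁ (x∈p∩q⁻ side _ v∈O))
        sel#O : Disjoint (selected (∁ U) outer attach X) (U ∩ O)
        sel#O u∈ u∈O = proj₂ (∈⟦⟧⁻ _ (proj₁ (∈⟦⟧⁻ _ u∈))) (X⊆core (union-separator⊆X N (proj₂ (x∈p∩q⁻ U O u∈O))))
        in-U-or-not : v ∈ O → v ∈ O ∩ ∁ U ⊎ v ∈ U ∩ O
        in-U-or-not {v} v∈O with v ∈? U
        ... | yes v∈U = inj₂ (x∈p∩q⁺ (v∈U , v∈O))
        ... | no v∉U = inj₁ (x∈p∩q⁺ (v∈O , x∉p⇒x∈∁p v∉U))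
        O∖U⊆X∖U : O ∩ ∁ U ⊆ X ∩ ∁ U
        O∖U⊆X∖U v∈ with x∈p∩q⁻ O (∁ U) v∈
        ... | v∈O , v∉U = x∈p∩q⁺ (union-separator⊆X N v∈O , v∉U)

    attach-sparse : Sparse (∁ U) K core outer attach 0
    attach-sparse X X⊆core ∣X∣≤K = Sparsity.sparse X X⊆core ∣X∣≤K

    U-bound : ∀ n → ∣ core ∣ ≤ n → K ≤ n → ∣ U ∣ ≤ K * (n C K)
    U-bound n ∣core∣≤n K≤n = ≤-trans (covered⇒∣r∣≤∣p∣+∣q∣ in-core-or-outer) (by-size (K ≤? ∣ core ∣))
      where
      open ≤-Reasoning
      a z : ℕ
      a = ∣ U ∩ core ∣
      z = ∣ core ∩ ∁ U ∣
      in-core-or-outer : ∀ {u} → u ∈ U → u ∈ U ∩ core ⊎ u ∈ outer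
      in-core-or-outer {u} u∈U with u ∈? core
      ... | yes u∈core = inj₁ (x∈p∩q⁺ (u∈U , u∈core))
      ... | no u∉core = inj₂ (∈⟦⟧⁺ _ (u∈U , u∉core))
      a+z≤∣core∣ : a + z ≤ ∣ core ∣
      a+z≤∣core∣ = disjoint⇒∣p∣+∣q∣≤∣r∣ (λ v∈₁ v∈₂ → x∈∁p⇒x∉p (proj₂ (x∈p∩q⁻ core _ v∈₂)) (proj₁ (x∈p∩q⁻ U _ v∈₁)))
                     (λ v∈ → proj₂ (x∈p∩q⁻ U core v∈)) (λ v∈ → proj₁ (x∈p∩q⁻ core _ v∈))
      by-size : Dec (K ≤ ∣ core ∣) → a + ∣ outer ∣ ≤ K * (n C K)
      by-size (yes K≤∣core∣) = begin
        a + ∣ outer ∣         ≤⟨ +-monoʳ-≤ a (count-bound (∁ U) K ∣ core ∣ refl K≤∣core∣ 0 attach-bounded attach-sparse) ⟩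
        a + bound K ∣ core ∣ z 0 ≤⟨ a+bound≤k*nCk K K>0 a+z≤∣core∣ K≤∣core∣ ∣core∣≤n ⟩
        K * (n C K)          ∎
      by-size (no K≰∣core∣) = begin
        a + ∣ outer ∣         ≤⟨ +-monoʳ-≤ a (p⊆q⇒∣p∣≤∣q∣ (all-selected (∁ U) core attach-bounded (λ v∈ → v∈))) ⟩
        a + ∣ selected (∁ U) outer attach core ∣ ≤⟨ +-monoʳ-≤ a (attach-sparse core (λ v∈ → v∈) (<⇒≤ (≰⇒> K≰∣core∣))) ⟩
        a + (z + 0)          ≡⟨ cong (a +_) (+-identityʳ z) ⟩
        a + z                ≤⟨ a+z≤∣core∣ ⟩
        ∣ core ∣              ≤⟨ ∣core∣≤n ⟩
        n                    ≤⟨ n≤k*nCk K>0 K≤n ⟩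
        K * (n C K)          ∎

    wide-bag : ∀ n → K ≤ n → (n C K) * K < ∣ U ∣ → WidthAtLeast D n
    wide-bag n K≤n U-huge with suc n ≤? ∣ core ∣ | enumerate core
    ... | yes n<∣core∣ | f , f-injective , f∈core =
      t , (λ i → f (inject≤ i n<∣core∣)) , (λ eq → inject≤-injective _ _ _ _ (f-injective eq)) , (λ i → core⊆bag (f∈core _))
    ... | no n≮∣core∣ | _ = ⊥-elim (<⇒≱ U-huge (≤-trans (U-bound n (≤-pred (≰⇒> n≮∣core∣)) K≤n) (≤-reflexive (*-comm K (n C K)))))

lemma3p2 : (θ n : ℕ) → 3 ≤ θ → θ ≤ n → (G : Graph) →
    (U : Subset (size G)) → ThetaConnected θ G U →
    (n C (θ ∸ 1)) * (θ ∸ 1) < ∣ U ∣ →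
    TreeWidthAtLeast θ G n
lemma3p2 (suc K) n (s≤s 2≤K) K<n G U U-connected U-huge D adhesion =
  AtSink.wide-bag (proj₁ sink) (proj₂ sink) n (<⇒≤ K<n) U-huge
  where
  K>0 : 0 < K
  K>0 = ≤-trans (s≤s z≤n) 2≤K
  3≤nCK : 3 ≤ n C K
  3≤nCK = ≤-trans (s≤s 2≤K) (k<n⇒1+k≤nCk K<n)
  U-large : 3 * K < ∣ U ∣
  U-large = begin-strict
    3 * K        ≤⟨ *-monoˡ-≤ K 3≤nCK ⟩
    (n C K) * K  <⟨ U-huge ⟩
    ∣ U ∣         ∎
    where open ≤-Reasoning
  open Sinks U K K>0 U-connected U-large D adhesion
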